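{- For every integer $n \geq 0$, the following polynomial identity holds in $\mathbb{C}[X]$: $$X^{\underline{n}} = B_n^* + \sum_{k=1}^{n} \frac{n}{k}\, s(n-1,k-1)\, B_k(X).$$
   Context: $X^{\underline{n}} := X(X-1)\cdots(X-n+1)$ (with $X^{\underline{0}}=1$). The (signed) Stirling numbers of the first kind $s(n,k)$ ($n,k\ge0$) are defined by $X^{\underline{n}} = \sum_{k=0}^{n} s(n,k) X^k$, with $s(n,k)=0$ for $n<k$. The Bernoulli polynomials $B_n(X)$ are defined by $\frac{t e^{Xt}}{e^t-1} = \sum_{n\ge 0} B_n(X)\frac{t^n}{n!}$. The Bernoulli numbers of the second kind $B_n^*$ are defined by $\frac{t}{\log(1+t)} = \sum_{n\ge 0} B_n^* \frac{t^n}{n!}$ (equivalently $B_n^* = \int_0^1 x^{\underline{n}}\,dx$). -}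

module Defs where

open import Data.Nat as ℕ using (ℕ; zero; suc; _!)
open import Data.Nat.Properties using (_!≢0; _!*_!≢0)
open import Data.Integer as ℤ using (ℤ; +_)
open import Data.Rational using (ℚ; 0ℚ; 1ℚ; _+_; _*_; _-_; -_; _/_)
open import Data.List using (List; []; _∷_; _++_; [_])

-- Polynomials over ℚ, represented by their coefficient sequence:
-- p i is the coefficient of X^i.  (All polynomials built below have
-- finite support.)
Poly : Set
Poly = ℕ → ℚ

ℕ→ℚ : ℕ → ℚ
ℕ→ℚ n = (+ n) / 1

const : ℚ → Poly
const c zero    = c
const c (suc i) = 0ℚ

mono : ℕ → ℚ → Poly
mono zero    c zero    = c
mono zero    c (suc i) = 0ℚ
mono (suc n) c zero    = 0ℚ
mono (suc n) c (suc i) = mono n c i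

zeroP : Poly
zeroP i = 0ℚ

_⊕_ : Poly → Poly → Poly
(p ⊕ q) i = p i + q i

_⊖_ : Poly → Poly → Poly
(p ⊖ q) i = p i - q i

_•_ : ℚ → Poly → Poly
(c • p) i = c * p i

infixl 6 _⊕_ _⊖_
infixl 7 _•_

mulXminus : ℚ → Poly → Poly
mulXminus c p zero    = - (c * p zero)
mulXminus c p (suc i) = p i - c * p (suc i)

falling : ℕ → Poly
falling zero    = const 1ℚ
falling (suc n) = mulXminus (ℕ→ℚ n) (falling n)

stirling1 : ℕ → ℕ → ℚ
stirling1 n k = falling n k

sumℚ : ℕ → (ℕ → ℚ) → ℚ
sumℚ zero    f = 0ℚ
sumℚ (suc n) f = sumℚ n f + f n

sumP : ℕ → (ℕ → Poly) → Poly
sumP zero    f = zeroP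
sumP (suc n) f = sumP n f ⊕ f n

-- Bernoulli polynomials, defined by  t e^{Xt}/(e^t - 1) = Σ B_n(X) t^n/n!.
-- Multiplying by (e^t-1)/t = Σ_m t^m/(m+1)! and comparing coefficients
-- of t^n gives   Σ_{k=0}^{n} B_k(X) / (k! (n-k+1)!) = X^n / n!,
-- which determines B_n(X) recursively:
--   B_n(X) = n! ( X^n/n! - Σ_{k<n} B_k(X) / (k! (n-k+1)!) ).
lookupP : List Poly → ℕ → Poly
lookupP []       k       = zeroP
lookupP (p ∷ ps) zero    = p
lookupP (p ∷ ps) (suc k) = lookupP ps k

nextBern : ℕ → List Poly → Poly
nextBern n bs =
  ℕ→ℚ (n !) •
    ( mono n (_/_ (+ 1) (n !) {{n !≢0}})
      ⊖ sumP n (λ k → (_/_ (+ 1) (k ! ℕ.* (suc (n ℕ.∸ k)) !) {{k !* (suc (n ℕ.∸ k)) !≢0}}) • lookupP bs k) )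

bernUpTo : ℕ → List Poly
bernUpTo zero    = []
bernUpTo (suc n) = bernUpTo n ++ [ nextBern n (bernUpTo n) ]

bernoulliPoly : ℕ → Poly
bernoulliPoly n = nextBern n (bernUpTo n)

-- Bernoulli numbers of the second kind:  B*_n = ∫_0^1 x^{\underline n} dx
--   = Σ_{k=0}^{n} s(n,k) / (k+1).
bernoulli2 : ℕ → ℚ
bernoulli2 n = sumℚ (suc n) (λ k → stirling1 n k * ((+ 1) / suc k))

-- The map p ↦ ∫_X^{X+1} p(t) dt is linear and sends X^j to a monic polynomial of
-- degree j, so it is injective; and the recurrence defining B_k says precisely that
-- it sends B_k to X^k.  It therefore suffices to compare images.  The image of
-- X^{\underline n} has constant term ∫_0^1 x^{\underline n} dx = B*_n, and its
-- derivative is (X+1)^{\underline n} − X^{\underline n} = n X^{\underline{n-1}}, so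
-- its coefficient of X^k is (n/k) s(n−1,k−1).  This is also the image of the
-- right-hand side.
module Submission where

open import Defs
open import Data.Nat using (ℕ; suc; _∸_)
open import Data.Integer using (+_)
open import Data.Rational using (_*_; _/_)
open import Relation.Binary.PropositionalEquality using (_≡_)

open import Level using (0ℓ)
open import Function using (_∘_)
open import Data.Sum using (inj₁; inj₂)
open import Data.List using ([]; _∷_; _++_; length)
open import Data.List.Properties using (length-++)
open import Data.Nat as ℕ using (zero; _≤_; _<_; z≤n; s≤s; _!; NonZero)
open import Data.Nat.Properties using (_!≢0; _!*_!≢0)
import Data.Nat.Properties as ℕP
open import Data.Nat.Combinatorics
  using (_C_; nCn≡1; k>n⇒nCk≡0; nCk≡n!/k![n-k]!; k![n∸k]!∣n!; nCk+nC[k+1]≡[n+1]C[k+1])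
open import Data.Nat.DivMod using (m/n*n≡m)
open import Data.Nat.Induction using (<-rec)
import Data.Nat.Tactic.RingSolver as ℕ-Solver
import Data.Integer as ℤ
import Data.Integer.Properties as ℤP
import Data.Integer.Tactic.RingSolver as ℤ-Solver
open import Data.Rational using (ℚ; 0ℚ; 1ℚ; _+_; _-_; -_; toℚᵘ)
import Data.Rational.Properties as ℚP
open ℚP using (_≟_; +-*-commutativeRing; toℚᵘ-injective; toℚᵘ-homo-+; toℚᵘ-homo-*; toℚᵘ-fromℚᵘ)
import Data.Rational.Unnormalised as ℚᵘ
import Data.Rational.Unnormalised.Properties as ℚᵘP
open import Algebra.Properties.Group ℚP.+-0-group
  using () renaming (x∙y⁻¹≈ε⇒x≈y to x-y≡0⇒x≡y; ∙-cancelʳ to +-cancelʳ)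
open import Tactic.RingSolver using (solve-∀)
open import Tactic.RingSolver.Core.AlmostCommutativeRing
  using (AlmostCommutativeRing; fromCommutativeRing)
open import Relation.Nullary using (yes; no; contradiction)
open import Relation.Nullary.Decidable using (dec⇒maybe)
open import Relation.Binary.Definitions using (tri<; tri≈; tri>)
open import Relation.Binary.PropositionalEquality
  using (_≢_; refl; sym; trans; cong; cong₂; subst; module ≡-Reasoning)

ringℚ : AlmostCommutativeRing 0ℓ 0ℓ
ringℚ = fromCommutativeRing +-*-commutativeRing (λ x → dec⇒maybe (0ℚ ≟ x))

1/ℕ : (d : ℕ) .{{_ : NonZero d}} → ℚ
1/ℕ d = (+ 1) / d

toℚᵘ-/ : ∀ i d → toℚᵘ (i / suc d) ℚᵘ.≃ ℚᵘ.mkℚᵘ i d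
toℚᵘ-/ i d = toℚᵘ-fromℚᵘ (ℚᵘ.mkℚᵘ i d)

ℕ→ℚ-+ : ∀ m n → ℕ→ℚ (m ℕ.+ n) ≡ ℕ→ℚ m + ℕ→ℚ n
ℕ→ℚ-+ m n = toℚᵘ-injective (begin
  toℚᵘ (ℕ→ℚ (m ℕ.+ n))                   ≈⟨ toℚᵘ-/ _ 0 ⟩
  ℚᵘ.mkℚᵘ (+ (m ℕ.+ n)) 0                ≈⟨ ℚᵘ.*≡* (trans (cong (ℤ._* + 1) (ℤP.pos-+ m n)) (distrib (+ m) (+ n))) ⟩
  ℚᵘ.mkℚᵘ (+ m) 0 ℚᵘ.+ ℚᵘ.mkℚᵘ (+ n) 0   ≈⟨ ℚᵘP.+-cong (toℚᵘ-/ (+ m) 0) (toℚᵘ-/ (+ n) 0) ⟨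
  toℚᵘ (ℕ→ℚ m) ℚᵘ.+ toℚᵘ (ℕ→ℚ n)         ≈⟨ toℚᵘ-homo-+ (ℕ→ℚ m) (ℕ→ℚ n) ⟨
  toℚᵘ (ℕ→ℚ m + ℕ→ℚ n)                   ∎)
  where
  open ℚᵘP.≃-Reasoning
  distrib : ∀ a b → (a ℤ.+ b) ℤ.* + 1 ≡ (a ℤ.* + 1 ℤ.+ b ℤ.* + 1) ℤ.* + 1
  distrib = ℤ-Solver.solve-∀

ℕ→ℚ[1+n]-1≡ℕ→ℚn : ∀ n → ℕ→ℚ (suc n) - 1ℚ ≡ ℕ→ℚ n
ℕ→ℚ[1+n]-1≡ℕ→ℚn n = trans (cong (_- 1ℚ) (ℕ→ℚ-+ 1 n)) (cancel (ℕ→ℚ n))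
  where
  cancel : ∀ x → 1ℚ + x - 1ℚ ≡ x
  cancel = solve-∀ ringℚ

ℕ→ℚ-* : ∀ m n → ℕ→ℚ (m ℕ.* n) ≡ ℕ→ℚ m * ℕ→ℚ n
ℕ→ℚ-* m n = toℚᵘ-injective (begin
  toℚᵘ (ℕ→ℚ (m ℕ.* n))                   ≈⟨ toℚᵘ-/ _ 0 ⟩
  ℚᵘ.mkℚᵘ (+ (m ℕ.* n)) 0                ≈⟨ ℚᵘ.*≡* (cong (ℤ._* + 1) (ℤP.pos-* m n)) ⟩
  ℚᵘ.mkℚᵘ (+ m) 0 ℚᵘ.* ℚᵘ.mkℚᵘ (+ n) 0   ≈⟨ ℚᵘP.*-cong (toℚᵘ-/ (+ m) 0) (toℚᵘ-/ (+ n) 0) ⟨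
  toℚᵘ (ℕ→ℚ m) ℚᵘ.* toℚᵘ (ℕ→ℚ n)         ≈⟨ toℚᵘ-homo-* (ℕ→ℚ m) (ℕ→ℚ n) ⟨
  toℚᵘ (ℕ→ℚ m * ℕ→ℚ n)                   ∎)
  where open ℚᵘP.≃-Reasoning

ℕ→ℚ*1/ℕ≡1 : ∀ d .{{_ : NonZero d}} → ℕ→ℚ d * 1/ℕ d ≡ 1ℚ
ℕ→ℚ*1/ℕ≡1 (suc d) = toℚᵘ-injective (begin
  toℚᵘ (ℕ→ℚ (suc d) * 1/ℕ (suc d))             ≈⟨ toℚᵘ-homo-* (ℕ→ℚ (suc d)) (1/ℕ (suc d)) ⟩
  toℚᵘ (ℕ→ℚ (suc d)) ℚᵘ.* toℚᵘ (1/ℕ (suc d))   ≈⟨ ℚᵘP.*-cong (toℚᵘ-/ (+ suc d) 0) (toℚᵘ-/ (+ 1) d) ⟩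
  ℚᵘ.mkℚᵘ (+ suc d) 0 ℚᵘ.* ℚᵘ.mkℚᵘ (+ 1) d     ≈⟨ ℚᵘP.*-inverseʳ (ℚᵘ.mkℚᵘ (+ suc d) 0) ⟩
  ℚᵘ.1ℚᵘ                                       ∎)
  where open ℚᵘP.≃-Reasoning

/≡ℕ→ℚ*1/ℕ : ∀ m d .{{_ : NonZero d}} → (+ m) / d ≡ ℕ→ℚ m * 1/ℕ d
/≡ℕ→ℚ*1/ℕ m (suc d) = toℚᵘ-injective (begin
  toℚᵘ ((+ m) / suc d)                     ≈⟨ toℚᵘ-/ (+ m) d ⟩
  ℚᵘ.mkℚᵘ (+ m) d                          ≈⟨ ℚᵘ.*≡* cross ⟩
  ℚᵘ.mkℚᵘ (+ m) 0 ℚᵘ.* ℚᵘ.mkℚᵘ (+ 1) d     ≈⟨ ℚᵘP.*-cong (toℚᵘ-/ (+ m) 0) (toℚᵘ-/ (+ 1) d) ⟨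
  toℚᵘ (ℕ→ℚ m) ℚᵘ.* toℚᵘ (1/ℕ (suc d))     ≈⟨ toℚᵘ-homo-* (ℕ→ℚ m) (1/ℕ (suc d)) ⟨
  toℚᵘ (ℕ→ℚ m * 1/ℕ (suc d))               ∎)
  where
  open ℚᵘP.≃-Reasoning
  cross : + m ℤ.* + (1 ℕ.* suc d) ≡ (+ m ℤ.* + 1) ℤ.* + suc d
  cross = trans (cong (λ x → + m ℤ.* + x) (ℕP.*-identityˡ (suc d)))
                (sym (cong (ℤ._* + suc d) (ℤP.*-identityʳ (+ m))))

ℕ→ℚ-*-cancelʳ : ∀ m d .{{_ : NonZero d}} → ℕ→ℚ (m ℕ.* d) * 1/ℕ d ≡ ℕ→ℚ m
ℕ→ℚ-*-cancelʳ m d = begin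
  ℕ→ℚ (m ℕ.* d) * 1/ℕ d     ≡⟨ cong (_* 1/ℕ d) (ℕ→ℚ-* m d) ⟩
  ℕ→ℚ m * ℕ→ℚ d * 1/ℕ d     ≡⟨ ℚP.*-assoc (ℕ→ℚ m) (ℕ→ℚ d) (1/ℕ d) ⟩
  ℕ→ℚ m * (ℕ→ℚ d * 1/ℕ d)   ≡⟨ cong (ℕ→ℚ m *_) (ℕ→ℚ*1/ℕ≡1 d) ⟩
  ℕ→ℚ m * 1ℚ                ≡⟨ ℚP.*-identityʳ (ℕ→ℚ m) ⟩
  ℕ→ℚ m                     ∎
  where open ≡-Reasoning

1/ℕ-*-cancelˡ : ∀ d .{{_ : NonZero d}} x → 1/ℕ d * (ℕ→ℚ d * x) ≡ x
1/ℕ-*-cancelˡ d x = begin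
  1/ℕ d * (ℕ→ℚ d * x)   ≡⟨ ℚP.*-assoc (1/ℕ d) (ℕ→ℚ d) x ⟨
  1/ℕ d * ℕ→ℚ d * x     ≡⟨ cong (_* x) (ℚP.*-comm (1/ℕ d) (ℕ→ℚ d)) ⟩
  ℕ→ℚ d * 1/ℕ d * x     ≡⟨ cong (_* x) (ℕ→ℚ*1/ℕ≡1 d) ⟩
  1ℚ * x                ≡⟨ ℚP.*-identityˡ x ⟩
  x                     ∎
  where open ≡-Reasoning

1/ℕ-unique : ∀ d .{{_ : NonZero d}} x → x * ℕ→ℚ d ≡ 1ℚ → x ≡ 1/ℕ d
1/ℕ-unique d x x*d≡1 = begin
  x                     ≡⟨ 1/ℕ-*-cancelˡ d x ⟨
  1/ℕ d * (ℕ→ℚ d * x)   ≡⟨ cong (1/ℕ d *_) (trans (ℚP.*-comm (ℕ→ℚ d) x) x*d≡1) ⟩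
  1/ℕ d * 1ℚ            ≡⟨ ℚP.*-identityʳ (1/ℕ d) ⟩
  1/ℕ d                 ∎
  where open ≡-Reasoning

sumℚ-cong : ∀ N {f g : ℕ → ℚ} → (∀ {j} → j < N → f j ≡ g j) → sumℚ N f ≡ sumℚ N g
sumℚ-cong zero    f≡g = refl
sumℚ-cong (suc N) f≡g =
  cong₂ _+_ (sumℚ-cong N (λ j<N → f≡g (ℕP.m<n⇒m<1+n j<N))) (f≡g (ℕP.n<1+n N))

sumℚ-zero : ∀ N {f : ℕ → ℚ} → (∀ {j} → j < N → f j ≡ 0ℚ) → sumℚ N f ≡ 0ℚ
sumℚ-zero N f≡0 = trans (sumℚ-cong N f≡0) (zeros N)
  where
  zeros : ∀ N → sumℚ N (λ _ → 0ℚ) ≡ 0ℚ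
  zeros zero    = refl
  zeros (suc N) = cong (_+ 0ℚ) (zeros N)

sumℚ-single : ∀ N {f : ℕ → ℚ} {k} → k < N → (∀ {j} → j < N → j ≢ k → f j ≡ 0ℚ) →
              sumℚ N f ≡ f k
sumℚ-single (suc N) {f} {k} k<1+N others with ℕP.m<1+n⇒m<n∨m≡n k<1+N
... | inj₁ k<N = begin
  sumℚ N f + f N   ≡⟨ cong₂ _+_ (sumℚ-single N k<N (others ∘ ℕP.m<n⇒m<1+n))
                                (others (ℕP.n<1+n N) (ℕP.<⇒≢ k<N ∘ sym)) ⟩
  f k + 0ℚ         ≡⟨ ℚP.+-identityʳ (f k) ⟩
  f k              ∎
  where open ≡-Reasoning
... | inj₂ refl = begin
  sumℚ N f + f N   ≡⟨ cong (_+ f N) (sumℚ-zero N (λ j<N →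
                        others (ℕP.m<n⇒m<1+n j<N) (ℕP.<⇒≢ j<N))) ⟩
  0ℚ + f N         ≡⟨ ℚP.+-identityˡ (f N) ⟩
  f N              ∎
  where open ≡-Reasoning

sumℚ-head : ∀ N (f : ℕ → ℚ) → sumℚ (suc N) f ≡ f 0 + sumℚ N (λ j → f (suc j))
sumℚ-head zero    f = trans (ℚP.+-identityˡ (f 0)) (sym (ℚP.+-identityʳ (f 0)))
sumℚ-head (suc N) f = trans (cong (_+ f (suc N)) (sumℚ-head N f))
                            (ℚP.+-assoc (f 0) (sumℚ N (λ j → f (suc j))) (f (suc N)))

sumℚ-distrib-+ : ∀ N (f g : ℕ → ℚ) → sumℚ N (λ j → f j + g j) ≡ sumℚ N f + sumℚ N g
sumℚ-distrib-+ zero    f g = refl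
sumℚ-distrib-+ (suc N) f g = trans (cong (_+ (f N + g N)) (sumℚ-distrib-+ N f g))
                                   (interchange (sumℚ N f) (sumℚ N g) (f N) (g N))
  where
  interchange : ∀ a b c d → a + b + (c + d) ≡ a + c + (b + d)
  interchange = solve-∀ ringℚ

sumℚ-distrib-sub : ∀ N (f g : ℕ → ℚ) → sumℚ N (λ j → f j - g j) ≡ sumℚ N f - sumℚ N g
sumℚ-distrib-sub zero    f g = refl
sumℚ-distrib-sub (suc N) f g = trans (cong (_+ (f N - g N)) (sumℚ-distrib-sub N f g))
                                   (interchange (sumℚ N f) (sumℚ N g) (f N) (g N))
  where
  interchange : ∀ a b c d → a - b + (c - d) ≡ a + c - (b + d)
  interchange = solve-∀ ringℚ

*-distribˡ-sumℚ : ∀ N c (f : ℕ → ℚ) → c * sumℚ N f ≡ sumℚ N (λ j → c * f j)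
*-distribˡ-sumℚ zero    c f = ℚP.*-zeroʳ c
*-distribˡ-sumℚ (suc N) c f =
  trans (ℚP.*-distribˡ-+ c (sumℚ N f) (f N)) (cong (_+ c * f N) (*-distribˡ-sumℚ N c f))

*-distribʳ-sumℚ : ∀ N c (f : ℕ → ℚ) → sumℚ N f * c ≡ sumℚ N (λ j → f j * c)
*-distribʳ-sumℚ zero    c f = ℚP.*-zeroˡ c
*-distribʳ-sumℚ (suc N) c f =
  trans (ℚP.*-distribʳ-+ c (sumℚ N f) (f N)) (cong (_+ f N * c) (*-distribʳ-sumℚ N c f))

sumℚ-comm : ∀ N M (f : ℕ → ℕ → ℚ) →
            sumℚ N (λ j → sumℚ M (f j)) ≡ sumℚ M (λ k → sumℚ N (λ j → f j k))
sumℚ-comm zero    M f = sym (sumℚ-zero M (λ _ → refl))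
sumℚ-comm (suc N) M f = trans (cong (_+ sumℚ M (f N)) (sumℚ-comm N M f))
                              (sym (sumℚ-distrib-+ M (λ k → sumℚ N (λ j → f j k)) (f N)))

sumP-apply : ∀ N (f : ℕ → Poly) i → sumP N f i ≡ sumℚ N (λ k → f k i)
sumP-apply zero    f i = refl
sumP-apply (suc N) f i = cong (_+ f N i) (sumP-apply N f i)

mono-diag : ∀ k c → mono k c k ≡ c
mono-diag zero    c = refl
mono-diag (suc k) c = mono-diag k c

mono-off : ∀ k c {i} → i ≢ k → mono k c i ≡ 0ℚ
mono-off zero    c {zero}  i≢k = contradiction refl i≢k
mono-off zero    c {suc i} i≢k = refl
mono-off (suc k) c {zero}  i≢k = refl
mono-off (suc k) c {suc i} i≢k = mono-off k c (i≢k ∘ cong suc)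

const≗mono : ∀ c i → const c i ≡ mono 0 c i
const≗mono c zero    = refl
const≗mono c (suc i) = refl

DegreeBelow : ℕ → Poly → Set
DegreeBelow N p = ∀ {i} → N ≤ i → p i ≡ 0ℚ

DegreeBelow-≤ : ∀ {N M p} → N ≤ M → DegreeBelow N p → DegreeBelow M p
DegreeBelow-≤ N≤M p<N M≤i = p<N (ℕP.≤-trans N≤M M≤i)

DegreeBelow-mono : ∀ k c → DegreeBelow (suc k) (mono k c)
DegreeBelow-mono k c k<i = mono-off k c (ℕP.>⇒≢ k<i)

DegreeBelow-const : ∀ c → DegreeBelow 1 (const c)
DegreeBelow-const c (s≤s z≤n) = refl

DegreeBelow-⊕ : ∀ {N p q} → DegreeBelow N p → DegreeBelow N q → DegreeBelow N (p ⊕ q)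
DegreeBelow-⊕ p<N q<N N≤i = cong₂ _+_ (p<N N≤i) (q<N N≤i)

DegreeBelow-⊖ : ∀ {N p q} → DegreeBelow N p → DegreeBelow N q → DegreeBelow N (p ⊖ q)
DegreeBelow-⊖ p<N q<N N≤i = cong₂ _-_ (p<N N≤i) (q<N N≤i)

DegreeBelow-• : ∀ {N p} c → DegreeBelow N p → DegreeBelow N (c • p)
DegreeBelow-• c p<N N≤i = trans (cong (c *_) (p<N N≤i)) (ℚP.*-zeroʳ c)

DegreeBelow-sumP : ∀ {N} K {f : ℕ → Poly} → (∀ {k} → k < K → DegreeBelow N (f k)) →
                   DegreeBelow N (sumP K f)
DegreeBelow-sumP K {f} f<N {i} N≤i = trans (sumP-apply K f i) (sumℚ-zero K (λ k<K → f<N k<K N≤i))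

-- The linear map X^j ↦ e j, on polynomials of degree < N.
linearMap : ℕ → (ℕ → Poly) → Poly → Poly
linearMap N e p i = sumℚ N (λ j → p j * e j i)

module _ (N : ℕ) (e : ℕ → Poly) where

  linearMap-cong : ∀ {p q} → (∀ {j} → j < N → p j ≡ q j) → ∀ i →
                   linearMap N e p i ≡ linearMap N e q i
  linearMap-cong p≡q i = sumℚ-cong N (λ j<N → cong (_* e _ i) (p≡q j<N))

  linearMap-⊕ : ∀ p q i → linearMap N e (p ⊕ q) i ≡ linearMap N e p i + linearMap N e q i
  linearMap-⊕ p q i = trans (sumℚ-cong N (λ {j} _ → ℚP.*-distribʳ-+ (e j i) (p j) (q j)))
                            (sumℚ-distrib-+ N _ _)

  linearMap-⊖ : ∀ p q i → linearMap N e (p ⊖ q) i ≡ linearMap N e p i - linearMap N e q i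
  linearMap-⊖ p q i = trans (sumℚ-cong N (λ {j} _ → distrib (p j) (q j) (e j i)))
                            (sumℚ-distrib-sub N _ _)
    where
    distrib : ∀ a b c → (a - b) * c ≡ a * c - b * c
    distrib = solve-∀ ringℚ

  linearMap-• : ∀ c p i → linearMap N e (c • p) i ≡ c * linearMap N e p i
  linearMap-• c p i = trans (sumℚ-cong N (λ {j} _ → ℚP.*-assoc c (p j) (e j i)))
                            (sym (*-distribˡ-sumℚ N c _))

  linearMap-sumP : ∀ K f i → linearMap N e (sumP K f) i ≡ sumℚ K (λ k → linearMap N e (f k) i)
  linearMap-sumP K f i = begin
    sumℚ N (λ j → sumP K f j * e j i)
      ≡⟨ sumℚ-cong N (λ {j} _ → cong (_* e j i) (sumP-apply K f j)) ⟩
    sumℚ N (λ j → sumℚ K (λ k → f k j) * e j i)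
      ≡⟨ sumℚ-cong N (λ {j} _ → *-distribʳ-sumℚ K (e j i) (λ k → f k j)) ⟩
    sumℚ N (λ j → sumℚ K (λ k → f k j * e j i))
      ≡⟨ sumℚ-comm N K (λ j k → f k j * e j i) ⟩
    sumℚ K (λ k → linearMap N e (f k) i)
      ∎
    where open ≡-Reasoning

  linearMap-mono : ∀ {k} c i → k < N → linearMap N e (mono k c) i ≡ c * e k i
  linearMap-mono {k} c i k<N = begin
    sumℚ N (λ j → mono k c j * e j i)
      ≡⟨ sumℚ-single N k<N (λ {j} _ j≢k →
           trans (cong (_* e j i) (mono-off k c j≢k)) (ℚP.*-zeroˡ (e j i))) ⟩
    mono k c k * e k i
      ≡⟨ cong (_* e k i) (mono-diag k c) ⟩
    c * e k i
      ∎
    where open ≡-Reasoning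

  linearMap-const : ∀ c i → 0 < N → linearMap N e (const c) i ≡ c * e 0 i
  linearMap-const c i 0<N =
    trans (linearMap-cong (λ {j} _ → const≗mono c j) i) (linearMap-mono c i 0<N)

  linearMap-suc : ∀ p i → p N ≡ 0ℚ → linearMap (suc N) e p i ≡ linearMap N e p i
  linearMap-suc p i pN≡0 = begin
    linearMap N e p i + p N * e N i   ≡⟨ cong (λ x → linearMap N e p i + x * e N i) pN≡0 ⟩
    linearMap N e p i + 0ℚ * e N i    ≡⟨ cong (_+_ (linearMap N e p i)) (ℚP.*-zeroˡ (e N i)) ⟩
    linearMap N e p i + 0ℚ            ≡⟨ ℚP.+-identityʳ _ ⟩
    linearMap N e p i                 ∎
    where open ≡-Reasoning

  linearMap-degree : (∀ j → DegreeBelow (suc j) (e j)) → ∀ p → DegreeBelow N (linearMap N e p)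
  linearMap-degree e<j+1 p N≤i = sumℚ-zero N (λ {j} j<N →
    trans (cong (p j *_) (e<j+1 j (ℕP.≤-trans j<N N≤i))) (ℚP.*-zeroʳ (p j)))

linearMap-identity : ∀ N {p} → DegreeBelow N p → ∀ i → linearMap N (λ j → mono j 1ℚ) p i ≡ p i
linearMap-identity N {p} p<N i with i ℕ.<? N
... | yes i<N = begin
  sumℚ N (λ j → p j * mono j 1ℚ i)
    ≡⟨ sumℚ-single N i<N (λ {j} _ j≢i →
         trans (cong (p j *_) (mono-off j 1ℚ (j≢i ∘ sym))) (ℚP.*-zeroʳ (p j))) ⟩
  p i * mono i 1ℚ i   ≡⟨ cong (p i *_) (mono-diag i 1ℚ) ⟩
  p i * 1ℚ            ≡⟨ ℚP.*-identityʳ (p i) ⟩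
  p i                 ∎
  where open ≡-Reasoning
... | no i≮N = trans (sumℚ-zero N (λ {j} j<N →
                       trans (cong (p j *_) (mono-off j 1ℚ (λ { refl → i≮N j<N }))) (ℚP.*-zeroʳ (p j))))
                     (sym (p<N (ℕP.≮⇒≥ i≮N)))

module _ {e : ℕ → Poly} (e<j+1 : ∀ j → DegreeBelow (suc j) (e j)) (e-diag : ∀ j → e j j ≡ 1ℚ) where

  linearMap-trivialKernel : ∀ N {p} → DegreeBelow N p → (∀ i → linearMap N e p i ≡ 0ℚ) →
                            ∀ i → p i ≡ 0ℚ
  linearMap-trivialKernel zero    p<0   _    i = p<0 z≤n
  linearMap-trivialKernel (suc N) {p} p<N+1 Lp≡0 =
    linearMap-trivialKernel N p<N (λ i → trans (sym (linearMap-suc N e p i pN≡0)) (Lp≡0 i))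
    where
    open ≡-Reasoning
    pN≡0 : p N ≡ 0ℚ
    pN≡0 = begin
      p N                       ≡⟨ ℚP.*-identityʳ (p N) ⟨
      p N * 1ℚ                  ≡⟨ cong (p N *_) (e-diag N) ⟨
      p N * e N N               ≡⟨ ℚP.+-identityˡ (p N * e N N) ⟨
      0ℚ + p N * e N N          ≡⟨ cong (_+ p N * e N N) (linearMap-degree N e e<j+1 p ℕP.≤-refl) ⟨
      linearMap (suc N) e p N   ≡⟨ Lp≡0 N ⟩
      0ℚ                        ∎
    p<N : DegreeBelow N p
    p<N N≤i with ℕP.m≤n⇒m<n∨m≡n N≤i
    ... | inj₁ N<i  = p<N+1 N<i
    ... | inj₂ refl = pN≡0

  linearMap-injective : ∀ N {p q} → DegreeBelow N p → DegreeBelow N q →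
                        (∀ i → linearMap N e p i ≡ linearMap N e q i) → ∀ i → p i ≡ q i
  linearMap-injective N {p} {q} p<N q<N Lp≡Lq i =
    x-y≡0⇒x≡y (p i) (q i) (linearMap-trivialKernel N (DegreeBelow-⊖ p<N q<N) L[p-q]≡0 i)
    where
    L[p-q]≡0 : ∀ i → linearMap N e (p ⊖ q) i ≡ 0ℚ
    L[p-q]≡0 i = trans (linearMap-⊖ N e p q i)
                       (trans (cong (_- linearMap N e q i) (Lp≡Lq i)) (ℚP.+-inverseʳ (linearMap N e q i)))

-- Multiplication by X − c and the falling factorial

mulX : Poly → Poly
mulX p zero    = 0ℚ
mulX p (suc i) = p i

mulXminus-as-mulX : ∀ c p i → mulXminus c p i ≡ (mulX p ⊖ c • p) i
mulXminus-as-mulX c p zero    = sym (ℚP.+-identityˡ (- (c * p 0)))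
mulXminus-as-mulX c p (suc i) = refl

mulXminus-cong : ∀ c {p q} → (∀ i → p i ≡ q i) → ∀ i → mulXminus c p i ≡ mulXminus c q i
mulXminus-cong c p≡q zero    = cong (λ x → - (c * x)) (p≡q 0)
mulXminus-cong c p≡q (suc i) = cong₂ (λ x y → x - c * y) (p≡q i) (p≡q (suc i))

mulXminus-⊕-• : ∀ c p a q i → mulXminus c (p ⊕ a • q) i ≡ mulXminus c p i + a * mulXminus c q i
mulXminus-⊕-• c p a q zero    = linear₀ c (p 0) a (q 0)
  where
  linear₀ : ∀ c x a y → - (c * (x + a * y)) ≡ - (c * x) + a * - (c * y)
  linear₀ = solve-∀ ringℚ
mulXminus-⊕-• c p a q (suc i) = linear c (p i) (p (suc i)) a (q i) (q (suc i))
  where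
  linear : ∀ c x x′ a y y′ → x + a * y - c * (x′ + a * y′) ≡ x - c * x′ + a * (y - c * y′)
  linear = solve-∀ ringℚ

mulXminus-pred : ∀ c p i → mulXminus (c - 1ℚ) p i ≡ mulXminus c p i + p i
mulXminus-pred c p zero    = pred₀ c (p 0)
  where
  pred₀ : ∀ c x → - ((c - 1ℚ) * x) ≡ - (c * x) + x
  pred₀ = solve-∀ ringℚ
mulXminus-pred c p (suc i) = pred c (p i) (p (suc i))
  where
  pred : ∀ c x x′ → x - (c - 1ℚ) * x′ ≡ x - c * x′ + x′
  pred = solve-∀ ringℚ

DegreeBelow-mulXminus : ∀ {N p} c → DegreeBelow N p → DegreeBelow (suc N) (mulXminus c p)
DegreeBelow-mulXminus {p = p} c p<N {suc i} (s≤s N≤i) = begin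
  p i - c * p (suc i)   ≡⟨ cong₂ (λ x y → x - c * y) (p<N N≤i) (p<N (ℕP.m≤n⇒m≤1+n N≤i)) ⟩
  0ℚ - c * 0ℚ           ≡⟨ cong (_-_ 0ℚ) (ℚP.*-zeroʳ c) ⟩
  0ℚ                    ∎
  where open ≡-Reasoning

falling-degree : ∀ n → DegreeBelow (suc n) (falling n)
falling-degree zero    = DegreeBelow-const 1ℚ
falling-degree (suc n) = DegreeBelow-mulXminus (ℕ→ℚ n) (falling-degree n)

-- The factor n makes the case n = 0, where n ∸ 1 = 0, harmless.
scaled-falling-step : ∀ n i →
  ℕ→ℚ n * mulXminus (ℕ→ℚ n - 1ℚ) (falling (n ∸ 1)) i ≡ ℕ→ℚ n * falling n i
scaled-falling-step zero    i =
  trans (ℚP.*-zeroˡ (mulXminus (0ℚ - 1ℚ) (falling 0) i)) (sym (ℚP.*-zeroˡ (falling 0 i)))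
scaled-falling-step (suc n) i =
  cong (λ c → ℕ→ℚ (suc n) * mulXminus c (falling n) i) (ℕ→ℚ[1+n]-1≡ℕ→ℚn n)

-- The shift p(X) ↦ p(X + 1)

[X+1]^_ : ℕ → Poly
([X+1]^ j) i = ℕ→ℚ (j C i)

shift : ℕ → Poly → Poly
shift N = linearMap N [X+1]^_

shift-mulX : ∀ N p i → shift (suc N) (mulX p) i ≡ mulX (shift N p) i + shift N p i
shift-mulX N p i = begin
  shift (suc N) (mulX p) i                       ≡⟨ sumℚ-head N _ ⟩
  0ℚ * ℕ→ℚ (0 C i) + S                           ≡⟨ cong (_+ S) (ℚP.*-zeroˡ (ℕ→ℚ (0 C i))) ⟩
  0ℚ + S                                         ≡⟨ ℚP.+-identityˡ S ⟩
  S                                              ≡⟨ pascal i ⟩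
  mulX (shift N p) i + shift N p i               ∎
  where
  open ≡-Reasoning
  S = sumℚ N (λ j → p j * ℕ→ℚ (suc j C i))
  pascal : ∀ i → sumℚ N (λ j → p j * ℕ→ℚ (suc j C i)) ≡ mulX (shift N p) i + shift N p i
  pascal zero    = sym (ℚP.+-identityˡ (shift N p 0))
  pascal (suc i) = trans (sumℚ-cong N (λ {j} _ → split j)) (sumℚ-distrib-+ N _ _)
    where
    split : ∀ j → p j * ℕ→ℚ (suc j C suc i) ≡ p j * ℕ→ℚ (j C i) + p j * ℕ→ℚ (j C suc i)
    split j = begin
      p j * ℕ→ℚ (suc j C suc i)                   ≡⟨ cong (λ c → p j * ℕ→ℚ c) (nCk+nC[k+1]≡[n+1]C[k+1] j i) ⟨
      p j * ℕ→ℚ (j C i ℕ.+ j C suc i)             ≡⟨ cong (p j *_) (ℕ→ℚ-+ (j C i) (j C suc i)) ⟩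
      p j * (ℕ→ℚ (j C i) + ℕ→ℚ (j C suc i))       ≡⟨ ℚP.*-distribˡ-+ (p j) _ _ ⟩
      p j * ℕ→ℚ (j C i) + p j * ℕ→ℚ (j C suc i)   ∎

shift-mulXminus : ∀ N {p} c → DegreeBelow N p → ∀ i →
                  shift (suc N) (mulXminus c p) i ≡ mulXminus (c - 1ℚ) (shift N p) i
shift-mulXminus N {p} c p<N i = begin
  shift (suc N) (mulXminus c p) i
    ≡⟨ linearMap-cong (suc N) [X+1]^_ (λ {j} _ → mulXminus-as-mulX c p j) i ⟩
  shift (suc N) (mulX p ⊖ c • p) i
    ≡⟨ linearMap-⊖ (suc N) [X+1]^_ (mulX p) (c • p) i ⟩
  shift (suc N) (mulX p) i - shift (suc N) (c • p) i
    ≡⟨ cong₂ _-_ (shift-mulX N p i) (linearMap-• (suc N) [X+1]^_ c p i) ⟩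
  mulX s i + s i - c * shift (suc N) p i
    ≡⟨ cong (λ x → mulX s i + s i - c * x) (linearMap-suc N [X+1]^_ p i (p<N ℕP.≤-refl)) ⟩
  mulX s i + s i - c * s i
    ≡⟨ regroup (mulX s i) (s i) c ⟩
  (mulX s ⊖ (c - 1ℚ) • s) i
    ≡⟨ mulXminus-as-mulX (c - 1ℚ) s i ⟨
  mulXminus (c - 1ℚ) s i
    ∎
  where
  open ≡-Reasoning
  s = shift N p
  regroup : ∀ a b c → a + b - c * b ≡ a - (c - 1ℚ) * b
  regroup = solve-∀ ringℚ

shift-falling : ∀ n i → shift (suc n) (falling n) i ≡ (falling n ⊕ ℕ→ℚ n • falling (n ∸ 1)) i
shift-falling zero    zero    = refl
shift-falling zero    (suc i) = refl
shift-falling (suc n) i = begin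
  shift (suc (suc n)) (mulXminus (ℕ→ℚ n) (falling n)) i
    ≡⟨ shift-mulXminus (suc n) (ℕ→ℚ n) (falling-degree n) i ⟩
  mulXminus c (shift (suc n) (falling n)) i
    ≡⟨ mulXminus-cong c (shift-falling n) i ⟩
  mulXminus c (falling n ⊕ ℕ→ℚ n • falling (n ∸ 1)) i
    ≡⟨ mulXminus-⊕-• c (falling n) (ℕ→ℚ n) (falling (n ∸ 1)) i ⟩
  mulXminus c (falling n) i + ℕ→ℚ n * mulXminus c (falling (n ∸ 1)) i
    ≡⟨ cong₂ _+_ (mulXminus-pred (ℕ→ℚ n) (falling n) i) (scaled-falling-step n i) ⟩
  falling (suc n) i + falling n i + ℕ→ℚ n * falling n i
    ≡⟨ regroup (falling (suc n) i) (falling n i) (ℕ→ℚ n) ⟩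
  falling (suc n) i + (1ℚ + ℕ→ℚ n) * falling n i
    ≡⟨ cong (λ x → falling (suc n) i + x * falling n i) (ℕ→ℚ-+ 1 n) ⟨
  falling (suc n) i + ℕ→ℚ (suc n) * falling n i
    ∎
  where
  open ≡-Reasoning
  c = ℕ→ℚ n - 1ℚ
  regroup : ∀ a b m → a + b + m * b ≡ a + (1ℚ + m) * b
  regroup = solve-∀ ringℚ

-- The integral p ↦ ∫_X^{X+1} p(t) dt

nCk*k![n∸k]!≡n! : ∀ {n k} → k ≤ n → (n C k) ℕ.* (k ! ℕ.* (n ∸ k) !) ≡ n !
nCk*k![n∸k]!≡n! {n} {k} k≤n =
  trans (cong (ℕ._* (k ! ℕ.* (n ∸ k) !)) (nCk≡n!/k![n-k]! k≤n))
        (m/n*n≡m {{k !* (n ∸ k) !≢0}} (k![n∸k]!∣n! k≤n))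

bernoulliWeight : ℕ → ℕ → ℚ
bernoulliWeight k m = 1/ℕ (m ! ℕ.* (suc (k ∸ m)) !) {{m !* (suc (k ∸ m)) !≢0}}

!*bernoulliWeight-diag : ∀ k → ℕ→ℚ (k !) * bernoulliWeight k k ≡ 1ℚ
!*bernoulliWeight-diag k =
  trans (cong (λ x → ℕ→ℚ x * bernoulliWeight k k) k!≡1*D)
        (ℕ→ℚ-*-cancelʳ 1 (k ! ℕ.* (suc (k ∸ k)) !) {{k !* (suc (k ∸ k)) !≢0}})
  where
  k!≡1*D : k ! ≡ 1 ℕ.* (k ! ℕ.* (suc (k ∸ k)) !)
  k!≡1*D = begin
    k !                               ≡⟨ ℕP.*-identityʳ (k !) ⟨
    k ! ℕ.* 1                         ≡⟨ ℕP.*-identityˡ (k ! ℕ.* 1) ⟨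
    1 ℕ.* (k ! ℕ.* (suc 0) !)         ≡⟨ cong (λ t → 1 ℕ.* (k ! ℕ.* (suc t) !)) (ℕP.n∸n≡0 k) ⟨
    1 ℕ.* (k ! ℕ.* (suc (k ∸ k)) !)   ∎
    where open ≡-Reasoning

[1+i]*j!*bernoulliWeight≡C : ∀ {i j} → i < j →
  ℕ→ℚ (suc i) * (ℕ→ℚ (j !) * bernoulliWeight j (suc i)) ≡ ℕ→ℚ (j C i)
[1+i]*j!*bernoulliWeight≡C {i} {j} i<j = begin
  ℕ→ℚ (suc i) * (ℕ→ℚ (j !) * w)   ≡⟨ ℚP.*-assoc (ℕ→ℚ (suc i)) (ℕ→ℚ (j !)) w ⟨
  ℕ→ℚ (suc i) * ℕ→ℚ (j !) * w     ≡⟨ cong (_* w) (ℕ→ℚ-* (suc i) (j !)) ⟨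
  ℕ→ℚ (suc i ℕ.* j !) * w         ≡⟨ cong (λ x → ℕ→ℚ x * w) factorials ⟩
  ℕ→ℚ ((j C i) ℕ.* D) * w         ≡⟨ ℕ→ℚ-*-cancelʳ (j C i) D {{suc i !* (suc (j ∸ suc i)) !≢0}} ⟩
  ℕ→ℚ (j C i)                     ∎
  where
  open ≡-Reasoning
  w = bernoulliWeight j (suc i)
  D = (suc i) ! ℕ.* (suc (j ∸ suc i)) !
  factorials : suc i ℕ.* j ! ≡ (j C i) ℕ.* D
  factorials = begin
    suc i ℕ.* j !
      ≡⟨ cong (suc i ℕ.*_) (nCk*k![n∸k]!≡n! (ℕP.<⇒≤ i<j)) ⟨
    suc i ℕ.* ((j C i) ℕ.* (i ! ℕ.* (j ∸ i) !))
      ≡⟨ regroup (suc i) (j C i) (i !) ((j ∸ i) !) ⟩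
    (j C i) ℕ.* ((suc i ℕ.* i !) ℕ.* (j ∸ i) !)
      ≡⟨ cong (λ t → (j C i) ℕ.* ((suc i) ! ℕ.* t !)) (ℕP.+-∸-assoc 1 i<j) ⟩
    (j C i) ℕ.* D
      ∎
    where
    regroup : ∀ a b c d → a ℕ.* (b ℕ.* (c ℕ.* d)) ≡ b ℕ.* ((a ℕ.* c) ℕ.* d)
    regroup = ℕ-Solver.solve-∀

-- ∫_X^{X+1} t^j dt = Σ_{m ≤ j} j!/(m!(j+1−m)!) X^m, with the weights of the
-- recurrence defining bernoulliPoly.
∫pow : ℕ → Poly
∫pow j i = ℕ→ℚ (j !) * sumℚ (suc j) (λ m → bernoulliWeight j m * mono m 1ℚ i)

∫ : ℕ → Poly → Poly
∫ N = linearMap N ∫pow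

∫pow-≤ : ∀ j {i} → i ≤ j → ∫pow j i ≡ ℕ→ℚ (j !) * bernoulliWeight j i
∫pow-≤ j {i} i≤j = cong (ℕ→ℚ (j !) *_) (begin
  sumℚ (suc j) (λ m → bernoulliWeight j m * mono m 1ℚ i)
    ≡⟨ sumℚ-single (suc j) (s≤s i≤j) (λ {m} _ m≢i →
         trans (cong (bernoulliWeight j m *_) (mono-off m 1ℚ (m≢i ∘ sym))) (ℚP.*-zeroʳ (bernoulliWeight j m))) ⟩
  bernoulliWeight j i * mono i 1ℚ i   ≡⟨ cong (bernoulliWeight j i *_) (mono-diag i 1ℚ) ⟩
  bernoulliWeight j i * 1ℚ            ≡⟨ ℚP.*-identityʳ _ ⟩
  bernoulliWeight j i                 ∎)
  where open ≡-Reasoning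

∫pow-degree : ∀ j → DegreeBelow (suc j) (∫pow j)
∫pow-degree j {i} j<i = trans (cong (ℕ→ℚ (j !) *_) (sumℚ-zero (suc j) vanish)) (ℚP.*-zeroʳ (ℕ→ℚ (j !)))
  where
  vanish : ∀ {m} → m < suc j → bernoulliWeight j m * mono m 1ℚ i ≡ 0ℚ
  vanish {m} m≤j = trans (cong (bernoulliWeight j m *_) (mono-off m 1ℚ (ℕP.>⇒≢ (ℕP.<-≤-trans m≤j j<i))))
                         (ℚP.*-zeroʳ (bernoulliWeight j m))

∫pow-diag : ∀ j → ∫pow j j ≡ 1ℚ
∫pow-diag j = trans (∫pow-≤ j ℕP.≤-refl) (!*bernoulliWeight-diag j)

∫pow-constant : ∀ j → ∫pow j 0 ≡ 1/ℕ (suc j)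
∫pow-constant j = trans (∫pow-≤ j z≤n) (1/ℕ-unique (suc j) (ℕ→ℚ (j !) * w) (begin
  ℕ→ℚ (j !) * w * ℕ→ℚ (suc j)   ≡⟨ swap (ℕ→ℚ (j !)) w (ℕ→ℚ (suc j)) ⟩
  ℕ→ℚ (j !) * ℕ→ℚ (suc j) * w   ≡⟨ cong (_* w) (ℕ→ℚ-* (j !) (suc j)) ⟨
  ℕ→ℚ (j ! ℕ.* suc j) * w       ≡⟨ cong (λ x → ℕ→ℚ x * w) factorials ⟩
  ℕ→ℚ (1 ℕ.* D) * w             ≡⟨ ℕ→ℚ-*-cancelʳ 1 D {{0 !* (suc j) !≢0}} ⟩
  1ℚ                            ∎))
  where
  open ≡-Reasoning
  w = bernoulliWeight j 0
  D = 0 ! ℕ.* (suc j) !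
  swap : ∀ a b c → a * b * c ≡ a * c * b
  swap = solve-∀ ringℚ
  factorials : j ! ℕ.* suc j ≡ 1 ℕ.* D
  factorials = trans (ℕP.*-comm (j !) (suc j)) (sym (trans (ℕP.*-identityˡ D) (ℕP.*-identityˡ ((suc j) !))))

∫pow-derivative : ∀ j i → ℕ→ℚ (suc i) * ∫pow j (suc i) + mono j 1ℚ i ≡ ℕ→ℚ (j C i)
∫pow-derivative j i with ℕP.<-cmp j i
... | tri< j<i _ _ = begin
  ℕ→ℚ (suc i) * ∫pow j (suc i) + mono j 1ℚ i
    ≡⟨ cong₂ (λ x y → ℕ→ℚ (suc i) * x + y) (∫pow-degree j (s≤s (ℕP.<⇒≤ j<i)))
                                             (mono-off j 1ℚ (ℕP.>⇒≢ j<i)) ⟩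
  ℕ→ℚ (suc i) * 0ℚ + 0ℚ   ≡⟨ cong (_+ 0ℚ) (ℚP.*-zeroʳ (ℕ→ℚ (suc i))) ⟩
  0ℚ                      ≡⟨ cong ℕ→ℚ (k>n⇒nCk≡0 j<i) ⟨
  ℕ→ℚ (j C i)             ∎
  where open ≡-Reasoning
... | tri≈ _ refl _ = begin
  ℕ→ℚ (suc i) * ∫pow i (suc i) + mono i 1ℚ i
    ≡⟨ cong₂ (λ x y → ℕ→ℚ (suc i) * x + y) (∫pow-degree i ℕP.≤-refl) (mono-diag i 1ℚ) ⟩
  ℕ→ℚ (suc i) * 0ℚ + 1ℚ   ≡⟨ cong (_+ 1ℚ) (ℚP.*-zeroʳ (ℕ→ℚ (suc i))) ⟩
  1ℚ                      ≡⟨ cong ℕ→ℚ (nCn≡1 i) ⟨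
  ℕ→ℚ (i C i)             ∎
  where open ≡-Reasoning
... | tri> _ _ i<j = begin
  ℕ→ℚ (suc i) * ∫pow j (suc i) + mono j 1ℚ i
    ≡⟨ cong₂ (λ x y → ℕ→ℚ (suc i) * x + y) (∫pow-≤ j i<j) (mono-off j 1ℚ (ℕP.<⇒≢ i<j)) ⟩
  ℕ→ℚ (suc i) * (ℕ→ℚ (j !) * bernoulliWeight j (suc i)) + 0ℚ
    ≡⟨ ℚP.+-identityʳ _ ⟩
  ℕ→ℚ (suc i) * (ℕ→ℚ (j !) * bernoulliWeight j (suc i))
    ≡⟨ [1+i]*j!*bernoulliWeight≡C i<j ⟩
  ℕ→ℚ (j C i)
    ∎
  where open ≡-Reasoning

-- (d/dX) ∫_X^{X+1} p(t) dt = p(X + 1) − p(X), compared coefficientwise.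
∫-derivative : ∀ N {p} → DegreeBelow N p → ∀ i → ℕ→ℚ (suc i) * ∫ N p (suc i) + p i ≡ shift N p i
∫-derivative N {p} p<N i = begin
  s * ∫ N p (suc i) + p i
    ≡⟨ cong₂ _+_ (*-distribˡ-sumℚ N s _) (sym (linearMap-identity N p<N i)) ⟩
  sumℚ N (λ j → s * (p j * ∫pow j (suc i))) + sumℚ N (λ j → p j * mono j 1ℚ i)
    ≡⟨ sumℚ-distrib-+ N _ _ ⟨
  sumℚ N (λ j → s * (p j * ∫pow j (suc i)) + p j * mono j 1ℚ i)
    ≡⟨ sumℚ-cong N (λ {j} _ → trans (regroup s (p j) (∫pow j (suc i)) (mono j 1ℚ i))
                                     (cong (p j *_) (∫pow-derivative j i))) ⟩
  shift N p i
    ∎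
  where
  open ≡-Reasoning
  s = ℕ→ℚ (suc i)
  regroup : ∀ s a b c → s * (a * b) + a * c ≡ a * (s * b + c)
  regroup = solve-∀ ringℚ

∫-falling-suc : ∀ n i → ∫ (suc n) (falling n) (suc i) ≡ ((+ n) / suc i) * stirling1 (n ∸ 1) i
∫-falling-suc n i = begin
  x                                           ≡⟨ 1/ℕ-*-cancelˡ (suc i) x ⟨
  1/ℕ (suc i) * (ℕ→ℚ (suc i) * x)             ≡⟨ cong (1/ℕ (suc i) *_) Δfalling ⟩
  1/ℕ (suc i) * (ℕ→ℚ n * falling (n ∸ 1) i)   ≡⟨ regroup (1/ℕ (suc i)) (ℕ→ℚ n) (falling (n ∸ 1) i) ⟩
  ℕ→ℚ n * 1/ℕ (suc i) * falling (n ∸ 1) i     ≡⟨ cong (_* falling (n ∸ 1) i) (/≡ℕ→ℚ*1/ℕ n (suc i)) ⟨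
  ((+ n) / suc i) * stirling1 (n ∸ 1) i       ∎
  where
  open ≡-Reasoning
  x = ∫ (suc n) (falling n) (suc i)
  Δfalling : ℕ→ℚ (suc i) * x ≡ ℕ→ℚ n * falling (n ∸ 1) i
  Δfalling = +-cancelʳ (falling n i) _ _ (begin
    ℕ→ℚ (suc i) * x + falling n i             ≡⟨ ∫-derivative (suc n) (falling-degree n) i ⟩
    shift (suc n) (falling n) i               ≡⟨ shift-falling n i ⟩
    falling n i + ℕ→ℚ n * falling (n ∸ 1) i   ≡⟨ ℚP.+-comm (falling n i) _ ⟩
    ℕ→ℚ n * falling (n ∸ 1) i + falling n i   ∎)
  regroup : ∀ u a b → u * (a * b) ≡ a * u * b
  regroup = solve-∀ ringℚ

∫-falling-zero : ∀ n → ∫ (suc n) (falling n) 0 ≡ bernoulli2 n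
∫-falling-zero n = sumℚ-cong (suc n) (λ {j} _ → cong (falling n j *_) (∫pow-constant j))

∫-falling : ∀ n i → ∫ (suc n) (falling n) i ≡
            (const (bernoulli2 n) ⊕ mulX (λ j → ((+ n) / suc j) * stirling1 (n ∸ 1) j)) i
∫-falling n zero    = trans (∫-falling-zero n) (sym (ℚP.+-identityʳ (bernoulli2 n)))
∫-falling n (suc i) = trans (∫-falling-suc n i) (sym (ℚP.+-identityˡ _))

-- Bernoulli polynomials

lookupP-++ˡ : ∀ xs ys {m} → m < length xs → lookupP (xs ++ ys) m ≡ lookupP xs m
lookupP-++ˡ (x ∷ xs) ys {zero}  _         = refl
lookupP-++ˡ (x ∷ xs) ys {suc m} (s≤s m<n) = lookupP-++ˡ xs ys m<n

lookupP-++-length : ∀ xs y ys → lookupP (xs ++ y ∷ ys) (length xs) ≡ y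
lookupP-++-length []       y ys = refl
lookupP-++-length (x ∷ xs) y ys = lookupP-++-length xs y ys

length-bernUpTo : ∀ k → length (bernUpTo k) ≡ k
length-bernUpTo zero    = refl
length-bernUpTo (suc k) =
  trans (length-++ (bernUpTo k)) (trans (ℕP.+-comm _ 1) (cong suc (length-bernUpTo k)))

lookupP-bernUpTo : ∀ k {m} → m < k → lookupP (bernUpTo k) m ≡ bernoulliPoly m
lookupP-bernUpTo (suc k) {m} m<k+1 with ℕP.m<1+n⇒m<n∨m≡n m<k+1
... | inj₁ m<k  = trans (lookupP-++ˡ (bernUpTo k) _ (subst (m <_) (sym (length-bernUpTo k)) m<k))
                        (lookupP-bernUpTo k m<k)
... | inj₂ refl = subst (λ t → lookupP (bernUpTo (suc m)) t ≡ bernoulliPoly m) (length-bernUpTo m)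
                        (lookupP-++-length (bernUpTo m) _ [])

bernoulliPoly-unfold : ∀ k i → bernoulliPoly k i ≡
  (ℕ→ℚ (k !) • (mono k (1/ℕ (k !) {{k !≢0}}) ⊖ sumP k (λ m → bernoulliWeight k m • bernoulliPoly m))) i
bernoulliPoly-unfold k i = cong (λ x → ℕ→ℚ (k !) * (mono k (1/ℕ (k !) {{k !≢0}}) i - x)) (begin
  sumP k (λ m → bernoulliWeight k m • lookupP (bernUpTo k) m) i
    ≡⟨ sumP-apply k _ i ⟩
  sumℚ k (λ m → bernoulliWeight k m * lookupP (bernUpTo k) m i)
    ≡⟨ sumℚ-cong k (λ {m} m<k → cong (λ p → bernoulliWeight k m * p i) (lookupP-bernUpTo k m<k)) ⟩
  sumℚ k (λ m → bernoulliWeight k m * bernoulliPoly m i)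
    ≡⟨ sumP-apply k _ i ⟨
  sumP k (λ m → bernoulliWeight k m • bernoulliPoly m) i
    ∎)
  where open ≡-Reasoning

bernoulliPoly-degree : ∀ k → DegreeBelow (suc k) (bernoulliPoly k)
bernoulliPoly-degree = <-rec (λ k → DegreeBelow (suc k) (bernoulliPoly k)) step
  where
  step : ∀ k → (∀ {m} → m < k → DegreeBelow (suc m) (bernoulliPoly m)) →
         DegreeBelow (suc k) (bernoulliPoly k)
  step k ih {i} k<i = trans (bernoulliPoly-unfold k i)
    (DegreeBelow-• (ℕ→ℚ (k !)) (DegreeBelow-⊖ (DegreeBelow-mono k _) (DegreeBelow-sumP k lower)) k<i)
    where
    lower : ∀ {m} → m < k → DegreeBelow (suc k) (bernoulliWeight k m • bernoulliPoly m)
    lower {m} m<k = DegreeBelow-• (bernoulliWeight k m) (DegreeBelow-≤ (ℕP.m≤n⇒m≤1+n m<k) (ih m<k))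

∫-bernoulliPoly : ∀ {N} k → k < N → ∀ i → ∫ N (bernoulliPoly k) i ≡ mono k 1ℚ i
∫-bernoulliPoly {N} = <-rec (λ k → k < N → ∀ i → ∫ N (bernoulliPoly k) i ≡ mono k 1ℚ i) step
  where
  step : ∀ k → (∀ {m} → m < k → m < N → ∀ i → ∫ N (bernoulliPoly m) i ≡ mono m 1ℚ i) →
         k < N → ∀ i → ∫ N (bernoulliPoly k) i ≡ mono k 1ℚ i
  step k ih k<N i = begin
    ∫ N (bernoulliPoly k) i
      ≡⟨ linearMap-cong N ∫pow (λ {j} _ → bernoulliPoly-unfold k j) i ⟩
    ∫ N (a • (mono k v ⊖ B<k)) i
      ≡⟨ linearMap-• N ∫pow a _ i ⟩
    a * ∫ N (mono k v ⊖ B<k) i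
      ≡⟨ cong (a *_) (linearMap-⊖ N ∫pow (mono k v) B<k i) ⟩
    a * (∫ N (mono k v) i - ∫ N B<k i)
      ≡⟨ cong₂ (λ x y → a * (x - y)) (linearMap-mono N ∫pow v i k<N) ∫B<k ⟩
    a * (v * (a * (T + c * δ)) - T)
      ≡⟨ regroup a v c T δ ⟩
    a * v * (a * T + a * c * δ) - a * T
      ≡⟨ cong₂ (λ x y → x * (a * T + y * δ) - a * T) (ℕ→ℚ*1/ℕ≡1 (k !) {{k !≢0}})
                                                      (!*bernoulliWeight-diag k) ⟩
    1ℚ * (a * T + 1ℚ * δ) - a * T
      ≡⟨ simplify (a * T) δ ⟩
    δ ∎
    where
    open ≡-Reasoning
    a = ℕ→ℚ (k !)
    v = 1/ℕ (k !) {{k !≢0}}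
    c = bernoulliWeight k k
    δ = mono k 1ℚ i
    B<k = sumP k (λ m → bernoulliWeight k m • bernoulliPoly m)
    T = sumℚ k (λ m → bernoulliWeight k m * mono m 1ℚ i)
    ∫B<k : ∫ N B<k i ≡ T
    ∫B<k = trans (linearMap-sumP N ∫pow k _ i) (sumℚ-cong k (λ {m} m<k →
      trans (linearMap-• N ∫pow (bernoulliWeight k m) (bernoulliPoly m) i)
            (cong (bernoulliWeight k m *_) (ih m<k (ℕP.<-trans m<k k<N) i))))
    regroup : ∀ a v c T δ → a * (v * (a * (T + c * δ)) - T) ≡ a * v * (a * T + a * c * δ) - a * T
    regroup = solve-∀ ringℚ
    simplify : ∀ x δ → 1ℚ * (x + 1ℚ * δ) - x ≡ δ
    simplify = solve-∀ ringℚ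

bernoulliCombination : ℚ → ℕ → (ℕ → ℚ) → Poly
bernoulliCombination c K a = const c ⊕ sumP K (λ j → a j • bernoulliPoly (suc j))

bernoulliCombination-degree : ∀ c K a → DegreeBelow (suc K) (bernoulliCombination c K a)
bernoulliCombination-degree c K a =
  DegreeBelow-⊕ (DegreeBelow-≤ (s≤s z≤n) (DegreeBelow-const c)) (DegreeBelow-sumP K summand)
  where
  summand : ∀ {j} → j < K → DegreeBelow (suc K) (a j • bernoulliPoly (suc j))
  summand {j} j<K = DegreeBelow-• (a j) (DegreeBelow-≤ (s≤s j<K) (bernoulliPoly-degree (suc j)))

∫-bernoulliCombination : ∀ {N} c K a → K < N → DegreeBelow K a → ∀ i →
                         ∫ N (bernoulliCombination c K a) i ≡ (const c ⊕ mulX a) i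
∫-bernoulliCombination {N} c K a K<N a<K i = begin
  ∫ N (bernoulliCombination c K a) i
    ≡⟨ linearMap-⊕ N ∫pow (const c) _ i ⟩
  ∫ N (const c) i + ∫ N (sumP K (λ j → a j • bernoulliPoly (suc j))) i
    ≡⟨ cong₂ _+_ (linearMap-const N ∫pow c i (ℕP.<-≤-trans (s≤s z≤n) K<N))
                 (linearMap-sumP N ∫pow K _ i) ⟩
  c * ∫pow 0 i + sumℚ K (λ j → ∫ N (a j • bernoulliPoly (suc j)) i)
    ≡⟨ cong (_+_ (c * ∫pow 0 i)) (sumℚ-cong K ∫summand) ⟩
  c * ∫pow 0 i + sumℚ K (λ j → a j * mono (suc j) 1ℚ i)
    ≡⟨ coefficients i ⟩
  (const c ⊕ mulX a) i
    ∎
  where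
  open ≡-Reasoning
  ∫summand : ∀ {j} → j < K → ∫ N (a j • bernoulliPoly (suc j)) i ≡ a j * mono (suc j) 1ℚ i
  ∫summand {j} j<K = trans (linearMap-• N ∫pow (a j) _ i)
                           (cong (a j *_) (∫-bernoulliPoly (suc j) (ℕP.<-≤-trans (s≤s j<K) K<N) i))
  coefficients : ∀ i → c * ∫pow 0 i + sumℚ K (λ j → a j * mono (suc j) 1ℚ i) ≡ (const c ⊕ mulX a) i
  coefficients zero    = cong₂ _+_ (trans (cong (c *_) (∫pow-diag 0)) (ℚP.*-identityʳ c))
                                   (sumℚ-zero K (λ {j} _ → ℚP.*-zeroʳ (a j)))
  coefficients (suc i) = cong₂ _+_ (trans (cong (c *_) (∫pow-degree 0 {suc i} (s≤s z≤n))) (ℚP.*-zeroʳ c))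
                                   (linearMap-identity K a<K i)

theorem3 : (n : ℕ) → (i : ℕ) →
    falling n i
      ≡ (const (bernoulli2 n)
          ⊕ sumP n (λ j → (((+ n) / suc j) * stirling1 (n ∸ 1) j) • bernoulliPoly (suc j))) i
theorem3 n = linearMap-injective ∫pow-degree ∫pow-diag (suc n)
  (falling-degree n) (bernoulliCombination-degree (bernoulli2 n) n a)
  (λ i → trans (∫-falling n i) (sym (∫-bernoulliCombination (bernoulli2 n) n a ℕP.≤-refl a-degree i)))
  where
  a : ℕ → ℚ
  a j = ((+ n) / suc j) * stirling1 (n ∸ 1) j
  a-degree : DegreeBelow n a
  a-degree {j} n≤j = begin
    a j                                       ≡⟨ ℚP.+-identityˡ (a j) ⟨
    (const (bernoulli2 n) ⊕ mulX a) (suc j)   ≡⟨ ∫-falling n (suc j) ⟨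
    ∫ (suc n) (falling n) (suc j)
      ≡⟨ linearMap-degree (suc n) ∫pow ∫pow-degree (falling n) (s≤s n≤j) ⟩
    0ℚ                                        ∎
    where open ≡-Reasoning
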